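{- Let $(G,\prec)$ be an ordered graph of maximum degree $d$. For every iterated subdivision $(G',\prec')$ of $(G,\prec)$, the overlap graph $\mathrm{Ov}(G',\prec')$ has no $K_{2d+2,2d+2}$ subgraph.
   Context: An ordered graph $(G,\prec)$ is a finite simple graph with a strict total order $\prec$ on $V(G)$. For an edge $e$, $L(e)$ and $R(e)$ denote its $\prec$-smaller and $\prec$-larger endpoint. Edges $e,f$ cross if $L(e)\prec L(f)\prec R(e)\prec R(f)$ or $L(f)\prec L(e)\prec R(f)\prec R(e)$. The overlap graph $\mathrm{Ov}(G,\prec)$ has vertex set $E(G)$ and an edge between any two crossing edges; subgraphs need not be induced. Flattening an edge $uv$ (with $u\prec v$) of an ordered graph, where the vertices strictly between $u$ and $v$ are $u_1\prec\dots\prec u_h$: delete $uv$, add $h+1$ new vertices $w_1,\dots,w_{h+1}$ placed in the order so that $u\prec w_1\prec u_1\prec w_2\prec u_2\prec\dots\prec w_h\prec u_h\prec w_{h+1}\prec v$, and add the edges $uw_1$, $w_iw_{i+1}$ for $i\in[h]$, and $w_{h+1}v$ (so $uv$ is replaced by a path). An iterated subdivision of $(G,\prec)$ is obtained by choosing a total order on $E(G)$ and flattening the original edges of $G$ one after another in this order, each in the current ordered graph (the newly created edges are not flattened). -}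

module Defs where

open import Data.Nat using (ℕ; zero; suc; _+_; _*_; _∸_; _≤_; _<_; _≤ᵇ_; _<ᵇ_)
open import Data.Bool using (if_then_else_)
open import Data.Product using (_×_; _,_; proj₁; proj₂; Σ; ∃-syntax)
open import Data.Sum using (_⊎_)
open import Data.List using (List; []; _∷_; _++_; map; length; filter; upTo)
open import Data.List.Relation.Unary.All using (All)
open import Data.List.Relation.Unary.Unique.Propositional using (Unique)
open import Data.List.Membership.Propositional using (_∈_)
open import Relation.Binary.PropositionalEquality using (_≡_)
open import Relation.Nullary using (¬_)
open import Data.Nat.Properties using (_≟_)
open import Relation.Nullary.Decidable using () renaming (_⊎-dec_ to _⊎?_)

-- Vertices of an ordered graph on n vertices are 0,1,…,n-1, ordered by <.
-- An edge is stored canonically as (L(e) , R(e)) with L(e) < R(e).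
Edge : Set
Edge = ℕ × ℕ

L R : Edge → ℕ
L = proj₁
R = proj₂

record OrderedGraph : Set where
  field
    n     : ℕ
    edges : List Edge
    wf    : All (λ e → L e < R e × R e < n) edges
    uniq  : Unique edges
open OrderedGraph public

deg : OrderedGraph → ℕ → ℕ
deg G x = length (filter (λ e → (L e ≟ x) ⊎? (R e ≟ x)) (edges G))

MaxDeg≤ : OrderedGraph → ℕ → Set
MaxDeg≤ G d = ∀ x → x < n G → deg G x ≤ d

Cross : Edge → Edge → Set
Cross e f = (L e < L f × L f < R e × R e < R f)
          ⊎ (L f < L e × L e < R f × R f < R e)

-- Ov(E) contains K_{t,t} as a (not necessarily induced) subgraph:
-- 2t distinct edges A ∪ B, |A| = |B| = t, every a ∈ A crossing every b ∈ B.
HasKtt : ℕ → List Edge → Set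
HasKtt t E = Σ (List Edge) λ A → Σ (List Edge) λ B →
    length A ≡ t × length B ≡ t × Unique (A ++ B)
  × All (_∈ E) (A ++ B)
  × All (λ a → All (λ b → Cross a b) B) A

-- Flattening the edge (u,v), u < v.  New position of an old vertex x:
-- the vertices u_k = u+k (0<k<v-u) get k new vertices before them,
-- vertices ≥ v get all v-u new vertices before them.
newPos : Edge → ℕ → ℕ
newPos (u , v) x =
  if x ≤ᵇ u then x
  else if x <ᵇ v then x + (x ∸ u)
  else x + (v ∸ u)

mapEdge : Edge → Edge → Edge
mapEdge e (a , b) = newPos e a , newPos e b

-- the new path u, w_1, …, w_{h+1}, v with h = v-u-1; in new positions
-- w_i sits at u + 2i - 1 and v at u + 2(v-u) = u + 2h + 2.
pathEdges : Edge → List Edge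
pathEdges (u , v) =
  (u , u + 1)
  ∷ (map (λ j → (u + 2 * j + 1 , u + 2 * j + 3)) (upTo h)
     ++ ((u + 2 * h + 1 , u + 2 * h + 2) ∷ []))
  where h = v ∸ u ∸ 1

-- Iterated subdivision.  `pending` = original edges still to be flattened
-- (in their ORIGINAL positions, in the chosen order); `pos` = the composed
-- relabelling of original vertex positions to current positions caused by
-- the flattenings performed so far; `done` = the current non-pending edges
-- (already in current positions).
iterFlatten : (ℕ → ℕ) → List Edge → List Edge → List Edge
iterFlatten pos []            done = done
iterFlatten pos (e₀ ∷ pending) done =
  iterFlatten (λ x → newPos e (pos x)) pending
              (map (mapEdge e) done ++ pathEdges e)
  where e = (pos (L e₀) , pos (R e₀))

-- Edge set of the iterated subdivision of G w.r.t. the edge order σ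
-- (σ is a listing of E(G), i.e. a permutation of `edges G`).
iteratedSubdivisionEdges : List Edge → List Edge
iteratedSubdivisionEdges σ = iterFlatten (λ x → x) σ []

{-# OPTIONS --safe #-}
-- Flattening an edge uv replaces it by a path whose edges have length 1 or 2:
-- a new vertex w_i is joined to w_{i+1}, jumping over the old vertex u_i.  An edge
-- of length at most 2 crosses only edges incident to the single vertex it jumps
-- over, so an edge of the path lying in a K_{t,t} of the overlap graph forces t
-- distinct edges through one vertex.  Flattening keeps the degree of every old
-- vertex (u and v trade uv for one path edge) and creates vertices of degree 2, so
-- all degrees stay at most max(d, 2) ≤ 2d + 1 < t = 2d + 2 (if G has an edge, then
-- d ≥ 1).  A K_{t,t} avoiding the new path consists of relabelled old edges, and
-- since relabelling is strictly increasing it reflects crossings, giving a K_{t,t}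
-- one step earlier.
module Submission where

open import Defs
open import Data.Nat using (ℕ; zero; suc; _+_; _*_; _∸_; _≤_; _<_; _⊓_; z≤n; s≤s; z<s; _<?_; _≤ᵇ_; _<ᵇ_)
open import Data.Nat.Properties
open import Data.Nat.Tactic.RingSolver using (solve-∀)
open import Data.Bool using (true; false; T)
open import Data.Product using (_×_; _,_; proj₁; ∃)
open import Data.Sum using (_⊎_; inj₁; inj₂; [_,_]′)
open import Data.Unit using (tt)
open import Data.List using (List; []; _∷_; _++_; [_]; map; length; filter; upTo; applyUpTo)
open import Data.List.Properties using (++-assoc; length-map; map-++; length-++; map-∘; map-id; map-upTo; filter-++; filter-accept; filter-reject; filter-none; filter-some; length-filter)
open import Data.List.Relation.Unary.All as All using (All; []; _∷_)
import Data.List.Relation.Unary.All.Properties as All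
open import Data.List.Relation.Unary.Any as Any using (Any; here; there)
open import Data.List.Relation.Unary.AllPairs using ([]; _∷_)
open import Data.List.Relation.Unary.Unique.Propositional using (Unique)
import Data.List.Relation.Unary.Unique.Propositional.Properties as Unique
open import Data.List.Membership.Propositional using (_∈_; find; lose)
open import Data.List.Membership.Propositional.Properties using (∈-++⁻; ∈-++⁺ˡ; ∈-++⁺ʳ; ∈-∃++; ∈-map⁻; ∈-filter⁺; ∈-upTo⁺)
open import Data.List.Relation.Binary.Permutation.Propositional using (_↭_; ↭-sym)
open import Data.List.Relation.Binary.Permutation.Propositional.Properties using (All-resp-↭; ↭-length; filter-↭)
open import Function using (_∘_; id)
open import Relation.Binary using (_Preserves_⟶_; tri<; tri≈; tri>)
open import Relation.Binary.PropositionalEquality hiding ([_])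
open import Relation.Nullary using (¬_; yes; no; contradiction)
open import Relation.Nullary.Decidable using () renaming (_⊎-dec_ to _⊎?_)
open import Relation.Unary using (Decidable)

Incident : ℕ → Edge → Set
Incident z e = L e ≡ z ⊎ R e ≡ z

incident? : ∀ z → Decidable (Incident z)
incident? z e = (L e ≟ z) ⊎? (R e ≟ z)

degIn : List Edge → ℕ → ℕ
degIn E z = length (filter (incident? z) E)

MaxDegIn≤ : List Edge → ℕ → Set
MaxDegIn≤ E D = ∀ z → degIn E z ≤ D

degIn-++ : ∀ X Y z → degIn (X ++ Y) z ≡ degIn X z + degIn Y z
degIn-++ X Y z = trans (cong length (filter-++ (incident? z) X Y)) (length-++ (filter (incident? z) X))

degIn-∷-≤ : ∀ e E z {m n} → degIn [ e ] z ≤ m → degIn E z ≤ n → degIn (e ∷ E) z ≤ m + n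
degIn-∷-≤ e E z p q = subst (_≤ _) (sym (degIn-++ [ e ] E z)) (+-mono-≤ p q)

degIn-[]≤1 : ∀ e z → degIn [ e ] z ≤ 1
degIn-[]≤1 e z = length-filter (incident? z) [ e ]

degIn-[]-incident : ∀ {e z} → Incident z e → degIn [ e ] z ≡ 1
degIn-[]-incident i = cong length (filter-accept (incident? _) i)

degIn-[]-avoid : ∀ {e z} → L e ≢ z → R e ≢ z → degIn [ e ] z ≡ 0
degIn-[]-avoid p q = cong length (filter-reject (incident? _) λ { (inj₁ r) → p r ; (inj₂ r) → q r })

degIn-∷-avoid : ∀ {e E z} → L e ≢ z → R e ≢ z → degIn (e ∷ E) z ≡ degIn E z
degIn-∷-avoid {e} {E} {z} p q = trans (degIn-++ [ e ] E z) (cong (_+ degIn E z) (degIn-[]-avoid p q))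

degIn-none : ∀ {E z} → All (¬_ ∘ Incident z) E → degIn E z ≡ 0
degIn-none {z = z} ¬E = cong length (filter-none (incident? z) ¬E)

MaxDegIn≤-resp-↭ : ∀ {X Y D} → X ↭ Y → MaxDegIn≤ X D → MaxDegIn≤ Y D
MaxDegIn≤-resp-↭ X↭Y bound z = subst (_≤ _) (↭-length (filter-↭ (incident? z) X↭Y)) (bound z)

Unique⇒length≤ : ∀ {a} {A : Set a} {xs ys : List A} → Unique xs → All (_∈ ys) xs → length xs ≤ length ys
Unique⇒length≤ [] [] = z≤n
Unique⇒length≤ {xs = x ∷ xs} (x∉xs ∷ uniq) (x∈ys ∷ xs⊆ys) with ys₁ , ys₂ , refl ← ∈-∃++ x∈ys =
  subst (suc (length xs) ≤_) length-around
    (s≤s (Unique⇒length≤ uniq (All.zipWith (λ (x≢y , y∈) → remove x≢y y∈) (x∉xs , xs⊆ys))))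
  where
  remove : ∀ {y} → x ≢ y → y ∈ ys₁ ++ x ∷ ys₂ → y ∈ ys₁ ++ ys₂
  remove x≢y y∈ with ∈-++⁻ ys₁ y∈
  ... | inj₁ y∈ys₁         = ∈-++⁺ˡ y∈ys₁
  ... | inj₂ (here y≡x)    = contradiction (sym y≡x) x≢y
  ... | inj₂ (there y∈ys₂) = ∈-++⁺ʳ ys₁ y∈ys₂
  length-around : suc (length (ys₁ ++ ys₂)) ≡ length (ys₁ ++ x ∷ ys₂)
  length-around = begin
    suc (length (ys₁ ++ ys₂))          ≡⟨ cong suc (length-++ ys₁) ⟩
    suc (length ys₁ + length ys₂)      ≡⟨ sym (+-suc (length ys₁) (length ys₂)) ⟩
    length ys₁ + length (x ∷ ys₂)      ≡⟨ sym (length-++ ys₁) ⟩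
    length (ys₁ ++ x ∷ ys₂)            ∎
    where open ≡-Reasoning

Unique-incident⇒≤degIn : ∀ {X E z} → Unique X → All (_∈ E) X → All (Incident z) X → length X ≤ degIn E z
Unique-incident⇒≤degIn {z = z} uniq X⊆E inc =
  Unique⇒length≤ uniq (All.zipWith (λ (x∈E , i) → ∈-filter⁺ (incident? z) x∈E i) (X⊆E , inc))

data AscendingPath : ℕ → ℕ → List Edge → Set where
  []  : ∀ {a} → AscendingPath a a []
  _∷_ : ∀ {a b c es} → a < b → AscendingPath b c es → AscendingPath a c ((a , b) ∷ es)

ascending-≤ : ∀ {a c es} → AscendingPath a c es → a ≤ c
ascending-≤ []          = ≤-refl
ascending-≤ (a<b ∷ path) = ≤-trans (<⇒≤ a<b) (ascending-≤ path)

degIn-ascending-outside : ∀ {a c es z} → AscendingPath a c es → z < a ⊎ c < z → degIn es z ≡ 0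
degIn-ascending-outside [] _ = refl
degIn-ascending-outside (a<b ∷ path) (inj₁ z<a) =
  trans (degIn-∷-avoid (>⇒≢ z<a) (>⇒≢ z<b)) (degIn-ascending-outside path (inj₁ z<b))
  where
  z<b = <-trans z<a a<b
degIn-ascending-outside (a<b ∷ path) (inj₂ c<z) =
  trans (degIn-∷-avoid (<⇒≢ (<-trans a<b b<z)) (<⇒≢ b<z)) (degIn-ascending-outside path (inj₂ c<z))
  where
  b<z = ≤-<-trans (ascending-≤ path) c<z

degIn-ascending-start : ∀ {a c es} → AscendingPath a c es → degIn es a ≤ 1
degIn-ascending-start []           = z≤n
degIn-ascending-start {a} (_∷_ {b = b} {es = es} a<b path) =
  degIn-∷-≤ (a , b) es a (degIn-[]≤1 (a , b) a) (≤-reflexive (degIn-ascending-outside path (inj₁ a<b)))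

degIn-ascending-end : ∀ {a c es} → AscendingPath a c es → degIn es c ≤ 1
degIn-ascending-end []                          = z≤n
degIn-ascending-end {a} {c} (_ ∷ [])           = degIn-∷-≤ (a , c) [] c (degIn-[]≤1 (a , c) c) z≤n
degIn-ascending-end (a<b ∷ path@(b<b′ ∷ path′)) =
  subst (_≤ 1) (sym (degIn-∷-avoid (<⇒≢ (<-trans a<b b<c)) (<⇒≢ b<c))) (degIn-ascending-end path)
  where
  b<c = <-≤-trans b<b′ (ascending-≤ path′)

degIn-ascending-≤2 : ∀ {a c es} → AscendingPath a c es → ∀ z → degIn es z ≤ 2
degIn-ascending-≤2 [] z = z≤n
degIn-ascending-≤2 {a} (_∷_ {b = b} {es = es} a<b path) z with <-cmp z b
... | tri< z<b _ _ =
  degIn-∷-≤ (a , b) es z (degIn-[]≤1 (a , b) z) (≤-trans (≤-reflexive (degIn-ascending-outside path (inj₁ z<b))) z≤n)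
... | tri≈ _ refl _ = degIn-∷-≤ (a , b) es b (degIn-[]≤1 (a , b) b) (degIn-ascending-start path)
... | tri> _ _ b<z =
  subst (_≤ 2) (sym (degIn-∷-avoid (<⇒≢ (<-trans a<b b<z)) (<⇒≢ b<z))) (degIn-ascending-≤2 path z)

StrictlyIncreasing : (ℕ → ℕ) → Set
StrictlyIncreasing f = f Preserves _<_ ⟶ _<_

relabel : (ℕ → ℕ) → Edge → Edge
relabel f e = f (L e) , f (R e)

module _ {f : ℕ → ℕ} (f↑ : StrictlyIncreasing f) where

  strictlyIncreasing⇒reflects-< : ∀ {x y} → f x < f y → x < y
  strictlyIncreasing⇒reflects-< {x} {y} fx<fy with <-cmp x y
  ... | tri< x<y _ _ = x<y
  ... | tri≈ _ refl _ = contradiction fx<fy (<-irrefl refl)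
  ... | tri> _ _ y<x = contradiction fx<fy (<-asym (f↑ y<x))

  strictlyIncreasing⇒injective : ∀ {x y} → f x ≡ f y → x ≡ y
  strictlyIncreasing⇒injective {x} {y} fx≡fy with <-cmp x y
  ... | tri< x<y _ _ = contradiction fx≡fy (<⇒≢ (f↑ x<y))
  ... | tri≈ _ x≡y _ = x≡y
  ... | tri> _ _ y<x = contradiction fx≡fy (>⇒≢ (f↑ y<x))

  strictlyIncreasing⇒inflationary : ∀ x → x ≤ f x
  strictlyIncreasing⇒inflationary zero    = z≤n
  strictlyIncreasing⇒inflationary (suc x) = ≤-<-trans (strictlyIncreasing⇒inflationary x) (f↑ (n<1+n x))

  -- A preimage of z, if any, is at most z, so a bounded search decides the image.
  image? : ∀ z → (∃ λ w → f w ≡ z) ⊎ (∀ w → f w ≢ z)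
  image? z with Any.any? (λ w → f w ≟ z) (upTo (suc z))
  ... | yes found = let w , _ , fw≡z = find found in inj₁ (w , fw≡z)
  ... | no ¬found = inj₂ λ w fw≡z →
    ¬found (lose (∈-upTo⁺ (s≤s (subst (w ≤_) fw≡z (strictlyIncreasing⇒inflationary w)))) fw≡z)

  Cross-relabel⁻ : ∀ {a b} → Cross (relabel f a) (relabel f b) → Cross a b
  Cross-relabel⁻ (inj₁ (p , q , r)) = inj₁ (reflect p , reflect q , reflect r)
    where reflect = strictlyIncreasing⇒reflects-<
  Cross-relabel⁻ (inj₂ (p , q , r)) = inj₂ (reflect p , reflect q , reflect r)
    where reflect = strictlyIncreasing⇒reflects-<

  degIn-relabel : ∀ w E → degIn (map (relabel f) E) (f w) ≡ degIn E w
  degIn-relabel w []      = refl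
  degIn-relabel w (x ∷ E) = begin
    degIn (relabel f x ∷ map (relabel f) E) (f w)               ≡⟨ degIn-++ [ relabel f x ] _ (f w) ⟩
    degIn [ relabel f x ] (f w) + degIn (map (relabel f) E) (f w) ≡⟨ cong₂ _+_ single (degIn-relabel w E) ⟩
    degIn [ x ] w + degIn E w                                     ≡⟨ sym (degIn-++ [ x ] E w) ⟩
    degIn (x ∷ E) w                                               ∎
    where
    open ≡-Reasoning
    inj = strictlyIncreasing⇒injective
    single : degIn [ relabel f x ] (f w) ≡ degIn [ x ] w
    single with incident? w x
    ... | yes (inj₁ p) = trans (degIn-[]-incident {relabel f x} (inj₁ (cong f p))) (sym (degIn-[]-incident {x} (inj₁ p)))
    ... | yes (inj₂ p) = trans (degIn-[]-incident {relabel f x} (inj₂ (cong f p))) (sym (degIn-[]-incident {x} (inj₂ p)))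
    ... | no ¬i = trans (degIn-[]-avoid {relabel f x} (λ p → ¬i (inj₁ (inj p))) (λ p → ¬i (inj₂ (inj p))))
                        (sym (degIn-[]-avoid {x} (λ p → ¬i (inj₁ p)) (λ p → ¬i (inj₂ p))))

degIn-relabel-outside : ∀ {f z} → (∀ w → f w ≢ z) → ∀ E → degIn (map (relabel f) E) z ≡ 0
degIn-relabel-outside ∉image E =
  degIn-none (All.map⁺ (All.universal (λ x → λ { (inj₁ p) → ∉image _ p ; (inj₂ p) → ∉image _ p }) E))

newPos-≡ : ∀ u v x → newPos (u , v) x ≡ x + (x ⊓ v ∸ u)
newPos-≡ u v x with x ≤ᵇ u in x≤ᵇu
... | true = sym (trans (cong (x +_) (m≤n⇒m∸n≡0 (≤-trans (m⊓n≤m x v) x≤u))) (+-identityʳ x))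
  where x≤u = ≤ᵇ⇒≤ x u (subst T (sym x≤ᵇu) tt)
... | false with x <ᵇ v in x<ᵇv
...   | true  = cong (λ y → x + (y ∸ u)) (sym (m≤n⇒m⊓n≡m (<⇒≤ (<ᵇ⇒< x v (subst T (sym x<ᵇv) tt)))))
...   | false = cong (λ y → x + (y ∸ u)) (sym (m≥n⇒m⊓n≡n (≮⇒≥ λ x<v → subst T x<ᵇv (<⇒<ᵇ x<v))))

newPos-strictlyIncreasing : ∀ e → StrictlyIncreasing (newPos e)
newPos-strictlyIncreasing (u , v) {x} {y} x<y rewrite newPos-≡ u v x | newPos-≡ u v y =
  +-mono-<-≤ x<y (∸-monoˡ-≤ u (⊓-monoˡ-≤ v (<⇒≤ x<y)))

newPos-≤ : ∀ u v {w} → w ≤ u → newPos (u , v) w ≡ w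
newPos-≤ u v {w} w≤u = begin
  newPos (u , v) w   ≡⟨ newPos-≡ u v w ⟩
  w + (w ⊓ v ∸ u)    ≡⟨ cong (w +_) (m≤n⇒m∸n≡0 (≤-trans (m⊓n≤m w v) w≤u)) ⟩
  w + 0              ≡⟨ +-identityʳ w ⟩
  w                  ∎
  where open ≡-Reasoning

newPos-inside : ∀ u h {k} → k ≤ suc h → newPos (u , u + suc h) (u + k) ≡ 2 * k + u
newPos-inside u h {k} k≤ = begin
  newPos (u , u + suc h) (u + k)        ≡⟨ newPos-≡ u (u + suc h) (u + k) ⟩
  u + k + ((u + k) ⊓ (u + suc h) ∸ u)   ≡⟨ cong (λ y → u + k + (y ∸ u)) (m≤n⇒m⊓n≡m (+-monoʳ-≤ u k≤)) ⟩
  u + k + (u + k ∸ u)                   ≡⟨ cong (u + k +_) (m+n∸m≡n u k) ⟩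
  u + k + k                             ≡⟨ rearrange u k ⟩
  2 * k + u                             ∎
  where
  open ≡-Reasoning
  rearrange : ∀ u k → u + k + k ≡ 2 * k + u
  rearrange = solve-∀

Short : Edge → Set
Short e = R e ≤ 2 + L e

<-squeeze : ∀ {a b c} → a < b → b < c → c ≤ 2 + a → b ≡ suc a
<-squeeze a<b b<c c≤2+a = ≤-antisym (≤-pred (<-≤-trans b<c c≤2+a)) a<b

Short-Cross⇒Incident : ∀ {c x} → Short c → Cross c x → Incident (suc (L c)) x
Short-Cross⇒Incident c-short (inj₁ (Lc<Lx , Lx<Rc , _)) = inj₁ (<-squeeze Lc<Lx Lx<Rc c-short)
Short-Cross⇒Incident c-short (inj₂ (_ , Lc<Rx , Rx<Rc)) = inj₂ (<-squeeze Lc<Rx Rx<Rc c-short)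

-- pathEdges (u , u + suc h) is (u , u + 1) followed by hops (u + 1) h: the new
-- vertices sit at u + 1, u + 3, …, u + 2h + 1, and each hop passes over an old vertex.
hop : ℕ → Edge
hop x = x , 2 + x

hops : ℕ → ℕ → List Edge
hops a zero    = (a , suc a) ∷ []
hops a (suc h) = hop a ∷ hops (2 + a) h

hops-ascending : ∀ a h → AscendingPath a (suc (2 * h + a)) (hops a h)
hops-ascending a zero    = n<1+n a ∷ []
hops-ascending a (suc h) =
  subst (λ c → AscendingPath a c (hops a (suc h))) (end a h)
    (s≤s (n≤1+n a) ∷ hops-ascending (2 + a) h)
  where
  end : ∀ a h → suc (2 * h + (2 + a)) ≡ suc (2 * suc h + a)
  end = solve-∀

hops-short : ∀ a h → All Short (hops a h)
hops-short a zero    = n≤1+n (suc a) ∷ []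
hops-short a (suc h) = ≤-refl ∷ hops-short (2 + a) h

hops-skipped : ∀ a h i → i < h → degIn (hops a h) (suc (2 * i + a)) ≡ 0
hops-skipped a (suc h) zero    _         =
  trans (degIn-∷-avoid (<⇒≢ (n<1+n a)) (>⇒≢ (n<1+n (suc a))))
        (degIn-ascending-outside (hops-ascending (2 + a) h) (inj₁ (n<1+n (suc a))))
hops-skipped a (suc h) (suc i) (s≤s i<h) = begin
  degIn (hops a (suc h)) (suc (2 * suc i + a))   ≡⟨ cong (degIn (hops a (suc h))) (shift a i) ⟩
  degIn (hops a (suc h)) z                       ≡⟨ degIn-∷-avoid (<⇒≢ (<-trans (s≤s (n≤1+n a)) 2+a<z)) (<⇒≢ 2+a<z) ⟩
  degIn (hops (2 + a) h) z                       ≡⟨ hops-skipped (2 + a) h i i<h ⟩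
  0                                              ∎
  where
  open ≡-Reasoning
  z = suc (2 * i + (2 + a))
  2+a<z = s≤s (m≤n+m (2 + a) (2 * i))
  shift : ∀ a i → suc (2 * suc i + a) ≡ suc (2 * i + (2 + a))
  shift = solve-∀

applyUpTo-hops : ∀ (g : ℕ → Edge) a h → (∀ j → g j ≡ hop (2 * j + a)) →
                 applyUpTo g h ++ [ (2 * h + a , suc (2 * h + a)) ] ≡ hops a h
applyUpTo-hops g a zero    g≡ = refl
applyUpTo-hops g a (suc h) g≡ = cong₂ _∷_ (g≡ 0)
  (trans (cong (λ x → applyUpTo (g ∘ suc) h ++ [ (x , suc x) ]) (shift a h))
         (applyUpTo-hops (g ∘ suc) (2 + a) h (λ j → trans (g≡ (suc j)) (cong hop (shift a j)))))
  where
  shift : ∀ a j → 2 * suc j + a ≡ 2 * j + (2 + a)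
  shift = solve-∀

pathEdges-hops : ∀ u h → pathEdges (u , u + suc h) ≡ (u , u + 1) ∷ hops (u + 1) h
pathEdges-hops u h rewrite m+n∸m≡n u (suc h) = cong ((u , u + 1) ∷_) (begin
  map odd-hop (upTo h) ++ [ (u + 2 * h + 1 , u + 2 * h + 2) ]
    ≡⟨ cong₂ _++_ (map-upTo odd-hop h) (cong [_] (cong₂ _,_ (odd u h) (odd+1 u h))) ⟩
  applyUpTo odd-hop h ++ [ (2 * h + (u + 1) , suc (2 * h + (u + 1))) ]
    ≡⟨ applyUpTo-hops odd-hop (u + 1) h (λ j → cong₂ _,_ (odd u j) (odd+2 u j)) ⟩
  hops (u + 1) h ∎)
  where
  open ≡-Reasoning
  odd-hop : ℕ → Edge
  odd-hop j = u + 2 * j + 1 , u + 2 * j + 3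
  odd : ∀ u j → u + 2 * j + 1 ≡ 2 * j + (u + 1)
  odd = solve-∀
  odd+1 : ∀ u j → u + 2 * j + 2 ≡ suc (2 * j + (u + 1))
  odd+1 = solve-∀
  odd+2 : ∀ u j → u + 2 * j + 3 ≡ 2 + (2 * j + (u + 1))
  odd+2 = solve-∀

pathEdges-ascending : ∀ u h → AscendingPath u (newPos (u , u + suc h) (u + suc h)) (pathEdges (u , u + suc h))
pathEdges-ascending u h =
  subst₂ (AscendingPath u) end (sym (pathEdges-hops u h)) (m<m+n u z<s ∷ hops-ascending (u + 1) h)
  where
  rearrange : ∀ u h → suc (2 * h + (u + 1)) ≡ 2 * suc h + u
  rearrange = solve-∀
  end : suc (2 * h + (u + 1)) ≡ newPos (u , u + suc h) (u + suc h)
  end = trans (rearrange u h) (sym (newPos-inside u h ≤-refl))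

pathEdges-short : ∀ u h → All Short (pathEdges (u , u + suc h))
pathEdges-short u h rewrite pathEdges-hops u h =
  subst (_≤ 2 + u) (+-comm 1 u) (n≤1+n (suc u)) ∷ hops-short (u + 1) h

data Position (u h : ℕ) : ℕ → Set where
  before : ∀ {w} → w < u → Position u h w
  start  : Position u h u
  inner  : ∀ i → i < h → Position u h (u + suc i)
  end    : Position u h (u + suc h)
  after  : ∀ {w} → u + suc h < w → Position u h w

position : ∀ u h w → Position u h w
position u h w with <-cmp w u
... | tri< w<u _ _ = before w<u
... | tri≈ _ refl _ = start
... | tri> _ _ u<w with o , refl ← m≤n⇒∃[o]m+o≡n u<w = subst (Position u h) (+-suc u o) (beyond o)
  where
  beyond : ∀ o → Position u h (u + suc o)
  beyond o with <-cmp o h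
  ... | tri< o<h _ _ = inner o o<h
  ... | tri≈ _ refl _ = end
  ... | tri> _ _ h<o = after (+-monoʳ-< u (s≤s h<o))

degIn-pathEdges-newPos : ∀ u h w → let e = (u , u + suc h) in
                         degIn (pathEdges e) (newPos e w) ≤ degIn [ e ] w
degIn-pathEdges-newPos u h w with position u h w
... | before w<u rewrite newPos-≤ u (u + suc h) (<⇒≤ w<u) =
  ≤-trans (≤-reflexive (degIn-ascending-outside (pathEdges-ascending u h) (inj₁ w<u))) z≤n
... | start rewrite newPos-≤ u (u + suc h) ≤-refl =
  ≤-trans (degIn-ascending-start (pathEdges-ascending u h))
          (≤-reflexive (sym (degIn-[]-incident {u , u + suc h} (inj₁ refl))))
... | end =
  ≤-trans (degIn-ascending-end (pathEdges-ascending u h))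
          (≤-reflexive (sym (degIn-[]-incident {u , u + suc h} (inj₂ refl))))
... | after v<w =
  ≤-trans (≤-reflexive (degIn-ascending-outside (pathEdges-ascending u h)
                          (inj₂ (newPos-strictlyIncreasing (u , u + suc h) v<w)))) z≤n
... | inner i i<h = ≤-trans (≤-reflexive skipped) z≤n
  where
  open ≡-Reasoning
  z = suc (2 * i + (u + 1))
  u+1<z : u + 1 < z
  u+1<z = s≤s (m≤n+m (u + 1) (2 * i))
  rearrange : ∀ u i → 2 * suc i + u ≡ suc (2 * i + (u + 1))
  rearrange = solve-∀
  skipped : degIn (pathEdges (u , u + suc h)) (newPos (u , u + suc h) (u + suc i)) ≡ 0
  skipped = begin
    degIn (pathEdges (u , u + suc h)) (newPos (u , u + suc h) (u + suc i))
      ≡⟨ cong₂ degIn (pathEdges-hops u h) (trans (newPos-inside u h (s≤s (<⇒≤ i<h))) (rearrange u i)) ⟩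
    degIn ((u , u + 1) ∷ hops (u + 1) h) z
      ≡⟨ degIn-∷-avoid (<⇒≢ (<-trans (m<m+n u z<s) u+1<z)) (<⇒≢ u+1<z) ⟩
    degIn (hops (u + 1) h) z
      ≡⟨ hops-skipped (u + 1) h i i<h ⟩
    0 ∎

flatten : Edge → List Edge → List Edge
flatten e E = map (mapEdge e) E ++ pathEdges e

<⇒∃suc : ∀ {u v} → u < v → ∃ λ h → u + suc h ≡ v
<⇒∃suc {u} u<v with o , u+1+o≡v ← m≤n⇒∃[o]m+o≡n u<v = o , trans (+-suc u o) u+1+o≡v

degIn-++-++ : ∀ X Y Z z → degIn (X ++ Y ++ Z) z ≡ degIn X z + degIn Y z + degIn Z z
degIn-++-++ X Y Z z =
  trans (degIn-++ X (Y ++ Z) z) (trans (cong (degIn X z +_) (degIn-++ Y Z z)) (sym (+-assoc (degIn X z) _ _)))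

flatten-maxDeg : ∀ {D u v} → 2 ≤ D → u < v → ∀ E Rs → MaxDegIn≤ (E ++ (u , v) ∷ Rs) D →
                 MaxDegIn≤ (flatten (u , v) E ++ map (mapEdge (u , v)) Rs) D
flatten-maxDeg {D} {u} 2≤D u<v E Rs bound z with h , refl ← <⇒∃suc u<v =
  [ oldVertex , newVertex ]′ (image? f↑ z)
  where
  open ≤-Reasoning
  e = (u , u + suc h)
  f = newPos e
  f↑ = newPos-strictlyIncreasing e
  P = pathEdges e
  split : ∀ z → degIn (flatten e E ++ map (mapEdge e) Rs) z
              ≡ degIn (map (mapEdge e) E) z + degIn P z + degIn (map (mapEdge e) Rs) z
  split z = trans (cong (λ X → degIn X z) (++-assoc (map (mapEdge e) E) P _))
                  (degIn-++-++ (map (mapEdge e) E) P (map (mapEdge e) Rs) z)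
  oldVertex : ∃ (λ w → f w ≡ z) → degIn (flatten e E ++ map (mapEdge e) Rs) z ≤ D
  oldVertex (w , fw≡z) = subst (λ z → degIn (flatten e E ++ map (mapEdge e) Rs) z ≤ D) fw≡z (begin
    degIn (flatten e E ++ map (mapEdge e) Rs) (f w)
      ≡⟨ split (f w) ⟩
    degIn (map (mapEdge e) E) (f w) + degIn P (f w) + degIn (map (mapEdge e) Rs) (f w)
      ≡⟨ cong₂ _+_ (cong (_+ degIn P (f w)) (degIn-relabel f↑ w E)) (degIn-relabel f↑ w Rs) ⟩
    degIn E w + degIn P (f w) + degIn Rs w
      ≤⟨ +-monoˡ-≤ (degIn Rs w) (+-monoʳ-≤ (degIn E w) (degIn-pathEdges-newPos u h w)) ⟩
    degIn E w + degIn [ e ] w + degIn Rs w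
      ≡⟨ degIn-++-++ E [ e ] Rs w ⟨
    degIn (E ++ e ∷ Rs) w
      ≤⟨ bound w ⟩
    D ∎)
  newVertex : (∀ w → f w ≢ z) → degIn (flatten e E ++ map (mapEdge e) Rs) z ≤ D
  newVertex ∉image = begin
    degIn (flatten e E ++ map (mapEdge e) Rs) z
      ≡⟨ split z ⟩
    degIn (map (mapEdge e) E) z + degIn P z + degIn (map (mapEdge e) Rs) z
      ≡⟨ cong₂ _+_ (cong (_+ degIn P z) (degIn-relabel-outside ∉image E)) (degIn-relabel-outside ∉image Rs) ⟩
    degIn P z + 0
      ≡⟨ +-identityʳ (degIn P z) ⟩
    degIn P z
      ≤⟨ degIn-ascending-≤2 (pathEdges-ascending u h) z ⟩
    2
      ≤⟨ 2≤D ⟩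
    D ∎

Cross-sym : ∀ {a b} → Cross a b → Cross b a
Cross-sym (inj₁ x) = inj₂ x
Cross-sym (inj₂ x) = inj₁ x

Unique-++⁻ˡ : ∀ {a} {A : Set a} (xs : List A) {ys} → Unique (xs ++ ys) → Unique xs
Unique-++⁻ˡ []       _             = []
Unique-++⁻ˡ (x ∷ xs) (x∉ ∷ uniq) = All.++⁻ˡ xs x∉ ∷ Unique-++⁻ˡ xs uniq

Unique-++⁻ʳ : ∀ {a} {A : Set a} (xs : List A) {ys} → Unique (xs ++ ys) → Unique ys
Unique-++⁻ʳ []       uniq       = uniq
Unique-++⁻ʳ (x ∷ xs) (_ ∷ uniq) = Unique-++⁻ʳ xs uniq

All-∈-++⁻ : ∀ {a} {A : Set a} (X Y : List A) {zs} → All (_∈ X ++ Y) zs → All (_∈ X) zs ⊎ Any (_∈ Y) zs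
All-∈-++⁻ X Y []         = inj₁ []
All-∈-++⁻ X Y (z∈ ∷ zs∈) with ∈-++⁻ X z∈ | All-∈-++⁻ X Y zs∈
... | inj₂ z∈Y | _          = inj₂ (here z∈Y)
... | inj₁ _   | inj₂ some  = inj₂ (there some)
... | inj₁ z∈X | inj₁ zs∈X = inj₁ (z∈X ∷ zs∈X)

All-∈-map⁻ : ∀ {a b} {A : Set a} {B : Set b} {f : A → B} {xs} ys →
             All (_∈ map f xs) ys → ∃ λ zs → map f zs ≡ ys × All (_∈ xs) zs
All-∈-map⁻ []       []         = [] , refl , []
All-∈-map⁻ (y ∷ ys) (y∈ ∷ ys∈) with z , z∈ , refl ← ∈-map⁻ _ y∈ | All-∈-map⁻ ys ys∈
... | zs , refl , zs∈ = z ∷ zs , refl , z∈ ∷ zs∈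

HasKtt-relabel⁻ : ∀ {f t} → StrictlyIncreasing f → ∀ E → HasKtt t (map (relabel f) E) → HasKtt t E
HasKtt-relabel⁻ {f} f↑ E (A , B , |A| , |B| , uniq , A∪B⊆ , cross)
  with A′ , refl , A′⊆E ← All-∈-map⁻ A (All.++⁻ˡ A A∪B⊆)
     | B′ , refl , B′⊆E ← All-∈-map⁻ B (All.++⁻ʳ A A∪B⊆) =
  A′ , B′ , trans (sym (length-map _ A′)) |A| , trans (sym (length-map _ B′)) |B|
  , Unique.map⁻ (subst Unique (sym (map-++ _ A′ B′)) uniq) , All.++⁺ A′⊆E B′⊆E
  , All.map (λ crossB → All.map (Cross-relabel⁻ f↑) (All.map⁻ crossB)) (All.map⁻ cross)

crossing-short≤maxDeg : ∀ {c X E D} → Short c → Unique X → All (_∈ E) X → All (Cross c) X →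
                        MaxDegIn≤ E D → length X ≤ D
crossing-short≤maxDeg {c} c-short uniq X⊆E cross bound =
  ≤-trans (Unique-incident⇒≤degIn uniq X⊆E (All.map (Short-Cross⇒Incident c-short) cross)) (bound (suc (L c)))

flatten-noKtt : ∀ {D u v} → u < v → ∀ E → MaxDegIn≤ (flatten (u , v) E) D →
                ¬ HasKtt (suc D) E → ¬ HasKtt (suc D) (flatten (u , v) E)
flatten-noKtt {D} {u} u<v E bound noKtt (A , B , |A| , |B| , uniq , A∪B⊆ , cross)
  with h , refl ← <⇒∃suc u<v | All-∈-++⁻ (map (mapEdge (u , u + suc h)) E) (pathEdges (u , u + suc h)) A∪B⊆
... | inj₁ A∪B⊆E =
  noKtt (HasKtt-relabel⁻ (newPos-strictlyIncreasing (u , u + suc h)) E (A , B , |A| , |B| , uniq , A∪B⊆E , cross))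
... | inj₂ meets with c , c∈A∪B , c∈P ← find meets | ∈-++⁻ A c∈A∪B
...   | inj₁ c∈A = 1+n≰n (subst (_≤ D) |B|
          (crossing-short≤maxDeg (All.lookup (pathEdges-short u h) c∈P) (Unique-++⁻ʳ A uniq) (All.++⁻ʳ A A∪B⊆)
                                  (All.lookup cross c∈A) bound))
...   | inj₂ c∈B = 1+n≰n (subst (_≤ D) |A|
          (crossing-short≤maxDeg (All.lookup (pathEdges-short u h) c∈P) (Unique-++⁻ˡ A uniq) (All.++⁻ˡ A A∪B⊆)
                                  (All.map (λ crossB → Cross-sym (All.lookup crossB c∈B)) cross) bound))

MaxDegIn≤-++⁻ˡ : ∀ {X Y D} → MaxDegIn≤ (X ++ Y) D → MaxDegIn≤ X D
MaxDegIn≤-++⁻ˡ {X} {Y} bound z = ≤-trans (m≤m+n _ _) (subst (_≤ _) (degIn-++ X Y z) (bound z))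

iterFlatten-noKtt : ∀ {D} → 2 ≤ D → ∀ pos pend E → StrictlyIncreasing pos → All (λ e → L e < R e) pend →
                    MaxDegIn≤ (E ++ map (relabel pos) pend) D → ¬ HasKtt (suc D) E →
                    ¬ HasKtt (suc D) (iterFlatten pos pend E)
iterFlatten-noKtt 2≤D pos []         E _    _                    _     noKtt = noKtt
iterFlatten-noKtt 2≤D pos (g ∷ pend) E pos↑ (Lg<Rg ∷ pend-asc) bound noKtt =
  iterFlatten-noKtt 2≤D (newPos e ∘ pos) pend (flatten e E) (newPos-strictlyIncreasing e ∘ pos↑) pend-asc bound′
    (flatten-noKtt e-asc E (MaxDegIn≤-++⁻ˡ {flatten e E} bound′) noKtt)
  where
  e = relabel pos g
  e-asc = pos↑ Lg<Rg
  bound′ : MaxDegIn≤ (flatten e E ++ map (relabel (newPos e ∘ pos)) pend) _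
  bound′ = subst (λ Rs → MaxDegIn≤ (flatten e E ++ Rs) _) (sym (map-∘ pend))
                 (flatten-maxDeg 2≤D e-asc E (map (relabel pos) pend) bound)

¬HasKtt-[] : ∀ {t} → ¬ HasKtt (suc t) []
¬HasKtt-[] (_ ∷ _ , _ , _ , _ , _ , () ∷ _ , _)

iteratedSubdivision-noKtt : ∀ {d} σ → MaxDegIn≤ σ d → All (λ e → L e < R e) σ →
                            ¬ HasKtt (suc (2 * d + 1)) (iteratedSubdivisionEdges σ)
iteratedSubdivision-noKtt []        _     _    = ¬HasKtt-[]
iteratedSubdivision-noKtt {d} σ@(g ∷ _) bound σ-asc =
  iterFlatten-noKtt 2≤D id σ [] id σ-asc bound′ ¬HasKtt-[]
  where
  d≤2d+1 : d ≤ 2 * d + 1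
  d≤2d+1 = ≤-trans (m≤m+n d (d + 0)) (m≤m+n (2 * d) 1)
  1≤d : 1 ≤ d
  1≤d = ≤-trans (filter-some (incident? (L g)) (here (inj₁ refl))) (bound (L g))
  2≤D : 2 ≤ 2 * d + 1
  2≤D = +-monoˡ-≤ 1 (≤-trans 1≤d (m≤m+n d (d + 0)))
  bound′ : MaxDegIn≤ (map (relabel id) σ) (2 * d + 1)
  bound′ z = subst (λ X → degIn X z ≤ 2 * d + 1) (sym (map-id σ)) (≤-trans (bound z) d≤2d+1)

MaxDeg≤⇒MaxDegIn≤ : ∀ G {d} → MaxDeg≤ G d → MaxDegIn≤ (edges G) d
MaxDeg≤⇒MaxDegIn≤ G maxDeg z with z <? n G
... | yes z<n = maxDeg z z<n
... | no  z≮n = subst (_≤ _) (sym (degIn-none (All.map outside (wf G)))) z≤n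
  where
  outside : ∀ {e} → L e < R e × R e < n G → ¬ Incident z e
  outside (L<R , R<n) (inj₁ refl) = z≮n (<-trans L<R R<n)
  outside (L<R , R<n) (inj₂ refl) = z≮n R<n

lemma27 : (G : OrderedGraph) (d : ℕ) → MaxDeg≤ G d →
          (σ : _) → σ ↭ edges G →
          ¬ HasKtt (2 * d + 2) (iteratedSubdivisionEdges σ)
lemma27 G d maxDeg σ σ↭E =
  subst (λ t → ¬ HasKtt t (iteratedSubdivisionEdges σ)) (sym (+-suc (2 * d) 1))
    (iteratedSubdivision-noKtt σ (MaxDegIn≤-resp-↭ (↭-sym σ↭E) (MaxDeg≤⇒MaxDegIn≤ G maxDeg))
                                 (All-resp-↭ (↭-sym σ↭E) (All.map proj₁ (wf G))))
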